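{- The formula $\neg\neg\Box p\to\Box\neg\neg p$ is derivable in $\mathsf{CK}\oplus N_\Diamond\oplus I_{\Diamond\Box}$ but not in $\mathsf{CK}\oplus N_{\Diamond\Box}\oplus C_\Diamond\oplus I_{\Diamond\Box}$ (hence not in $\mathsf{CK}\oplus N_{\Diamond\Box}\oplus I_{\Diamond\Box}$).
   Context: Formulas are built from a countably infinite set of propositional variables by $\varphi ::= p \mid \bot \mid \varphi\wedge\varphi \mid \varphi\vee\varphi \mid \varphi\to\varphi \mid \Box\varphi \mid \Diamond\varphi$; $\neg\varphi:=\varphi\to\bot$. For a set $\mathsf{Ax}$ of formulas, $\mathsf{CK}\oplus\mathsf{Ax}$ is the logic whose derivable formulas are generated by: substitution instances of axioms of a standard Hilbert axiomatisation of intuitionistic propositional logic, of $\Box(p\to q)\to(\Box p\to\Box q)$, of $\Box(p\to q)\to(\Diamond p\to\Diamond q)$, and of formulas in $\mathsf{Ax}$; modus ponens; necessitation (from $\varphi$ infer $\Box\varphi$). $\mathsf{CK}\oplus A_1\oplus\dots\oplus A_n$ denotes $\mathsf{CK}\oplus\{A_1,\dots,A_n\}$. Axioms: $N_\Diamond$: $\Diamond\bot\to\bot$; $N_{\Diamond\Box}$: $\Diamond\bot\to\Box\bot$; $C_\Diamond$: $\Diamond(p\vee q)\to\Diamond p\vee\Diamond q$; $I_{\Diamond\Box}$: $(\Diamond p\to\Box q)\to\Box(p\to q)$. -}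

module Defs where

open import Data.Nat using (ℕ)
open import Data.List using (List; []; _∷_)
open import Data.List.Membership.Propositional using (_∈_)

infixr 5 _⇒_
infixr 6 _∨_
infixr 7 _∧_
data Fm : Set where
  var  : ℕ → Fm
  ⊥'   : Fm
  _∧_  : Fm → Fm → Fm
  _∨_  : Fm → Fm → Fm
  _⇒_  : Fm → Fm → Fm
  □    : Fm → Fm
  ◇    : Fm → Fm

¬' : Fm → Fm
¬' φ = φ ⇒ ⊥'

Subst : Set
Subst = ℕ → Fm

sub : Subst → Fm → Fm
sub σ (var n) = σ n
sub σ ⊥'      = ⊥'
sub σ (φ ∧ ψ) = sub σ φ ∧ sub σ ψ
sub σ (φ ∨ ψ) = sub σ φ ∨ sub σ ψ
sub σ (φ ⇒ ψ) = sub σ φ ⇒ sub σ ψ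
sub σ (□ φ)   = □ (sub σ φ)
sub σ (◇ φ)   = ◇ (sub σ φ)

p q r : Fm
p = var 0
q = var 1
r = var 2

data CKAx : Fm → Set where
  ax-K1  : CKAx (p ⇒ (q ⇒ p))
  ax-S   : CKAx ((p ⇒ (q ⇒ r)) ⇒ ((p ⇒ q) ⇒ (p ⇒ r)))
  ax-∧1  : CKAx (p ∧ q ⇒ p)
  ax-∧2  : CKAx (p ∧ q ⇒ q)
  ax-∧I  : CKAx (p ⇒ (q ⇒ p ∧ q))
  ax-∨1  : CKAx (p ⇒ p ∨ q)
  ax-∨2  : CKAx (q ⇒ p ∨ q)
  ax-∨E  : CKAx ((p ⇒ r) ⇒ ((q ⇒ r) ⇒ (p ∨ q ⇒ r)))
  ax-⊥   : CKAx (⊥' ⇒ p)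
  ax-K□  : CKAx (□ (p ⇒ q) ⇒ (□ p ⇒ □ q))
  ax-K◇  : CKAx (□ (p ⇒ q) ⇒ (◇ p ⇒ ◇ q))

-- Derivability in CK ⊕ Ax, where Ax is a (finite) list of extra axioms.
data _⊢_ (Ax : List Fm) : Fm → Set where
  base  : ∀ {φ} → CKAx φ → (σ : Subst) → Ax ⊢ sub σ φ
  extra : ∀ {φ} → φ ∈ Ax → (σ : Subst) → Ax ⊢ sub σ φ
  mp    : ∀ {φ ψ} → Ax ⊢ (φ ⇒ ψ) → Ax ⊢ φ → Ax ⊢ ψ
  nec   : ∀ {φ} → Ax ⊢ φ → Ax ⊢ □ φ

N◇ N◇□ C◇ I◇□ : Fm
N◇  = ◇ ⊥' ⇒ ⊥'
N◇□ = ◇ ⊥' ⇒ □ ⊥'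
C◇  = ◇ (p ∨ q) ⇒ ◇ p ∨ ◇ q
I◇□ = (◇ p ⇒ □ q) ⇒ □ (p ⇒ q)

target : Fm
target = ¬' (¬' (□ p)) ⇒ □ (¬' (¬' p))

{-# OPTIONS --safe #-}
-- Derivability: by K◇ and N◇, □p refutes ◇¬p, hence so does ¬¬□p; ex falso weakens this
-- refutation to ◇¬p → □⊥, which I◇□ turns into □¬¬p.
-- Underivability: on the Heyting chain 0 < m < 1 put □x = m ∨ x and ◇x = m ∨ ¬¬x. This
-- validates CK, N◇□, C◇ and I◇□ and is closed under modus ponens and necessitation, yet at
-- p = 0 the target evaluates to ¬¬m → □0 = 1 → m = m.
module Submission where

open import Defs
open import Data.List using (List; []; _∷_)
open import Data.List.Membership.Propositional using (_∈_)
open import Data.List.Relation.Binary.Subset.Propositional using (_⊆_)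
open import Data.List.Relation.Binary.Subset.Propositional.Properties using (xs⊆x∷xs; ∷⁺ʳ)
open import Data.List.Relation.Unary.All as All using (All; []; _∷_)
open import Data.List.Relation.Unary.Any using (here; there)
open import Data.Nat using (ℕ; zero; suc)
open import Data.Product using (_×_; _,_)
open import Function using (_∘_)
open import Relation.Binary.PropositionalEquality using (_≡_; refl; trans; cong; cong₂)
open import Relation.Nullary using (¬_; Dec; yes; no)
open import Relation.Nullary.Decidable using (True; toWitness; map′; _×-dec_)

variable
  A : Set
  φ ψ χ : Fm
  Ax Bx : List Fm

⟨_,_,_⟩ : A → A → A → ℕ → A
⟨ x , y , z ⟩ zero          = x
⟨ x , y , z ⟩ (suc zero)    = y
⟨ x , y , z ⟩ (suc (suc _)) = z

⊢-mono : Ax ⊆ Bx → Ax ⊢ φ → Bx ⊢ φ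
⊢-mono Ax⊆Bx (base ax σ)      = base ax σ
⊢-mono Ax⊆Bx (extra φ∈Ax σ) = extra (Ax⊆Bx φ∈Ax) σ
⊢-mono Ax⊆Bx (mp d e)        = mp (⊢-mono Ax⊆Bx d) (⊢-mono Ax⊆Bx e)
⊢-mono Ax⊆Bx (nec d)         = nec (⊢-mono Ax⊆Bx d)

module _ {Ax : List Fm} where

  ⇒-const : Ax ⊢ (φ ⇒ ψ ⇒ φ)
  ⇒-const {φ} {ψ} = base ax-K1 ⟨ φ , ψ , ⊥' ⟩

  ⇒-distrib : Ax ⊢ ((φ ⇒ ψ ⇒ χ) ⇒ (φ ⇒ ψ) ⇒ φ ⇒ χ)
  ⇒-distrib {φ} {ψ} {χ} = base ax-S ⟨ φ , ψ , χ ⟩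

  ⇒-refl : Ax ⊢ (φ ⇒ φ)
  ⇒-refl {φ} = mp (mp ⇒-distrib (⇒-const {ψ = φ ⇒ φ})) ⇒-const

  ⇒-intro : Ax ⊢ ψ → Ax ⊢ (φ ⇒ ψ)
  ⇒-intro = mp ⇒-const

  ⇒-postcomp : Ax ⊢ (ψ ⇒ χ) → Ax ⊢ ((φ ⇒ ψ) ⇒ φ ⇒ χ)
  ⇒-postcomp ψ⇒χ = mp ⇒-distrib (⇒-intro ψ⇒χ)

  infixr 4 _⨾_
  _⨾_ : Ax ⊢ (φ ⇒ ψ) → Ax ⊢ (ψ ⇒ χ) → Ax ⊢ (φ ⇒ χ)
  φ⇒ψ ⨾ ψ⇒χ = mp (⇒-postcomp ψ⇒χ) φ⇒ψ

  ⇒-swap : Ax ⊢ (φ ⇒ ψ ⇒ χ) → Ax ⊢ (ψ ⇒ φ ⇒ χ)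
  ⇒-swap φ⇒ψ⇒χ = ⇒-const ⨾ mp ⇒-distrib φ⇒ψ⇒χ

  ⇒-apply : Ax ⊢ (φ ⇒ (φ ⇒ ψ) ⇒ ψ)
  ⇒-apply = ⇒-swap ⇒-refl

  contrapose : Ax ⊢ (φ ⇒ ψ) → Ax ⊢ (¬' ψ ⇒ ¬' φ)
  contrapose φ⇒ψ = ⇒-swap (φ⇒ψ ⨾ ⇒-apply)

  □-mono : Ax ⊢ (φ ⇒ ψ) → Ax ⊢ (□ φ ⇒ □ ψ)
  □-mono {φ} {ψ} φ⇒ψ = mp (base ax-K□ ⟨ φ , ψ , ⊥' ⟩) (nec φ⇒ψ)

  □⇒¬◇¬ : N◇ ∈ Ax → Ax ⊢ (□ φ ⇒ ¬' (◇ (¬' φ)))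
  □⇒¬◇¬ {φ} n◇ = □-mono ⇒-apply ⨾ base ax-K◇ ⟨ ¬' φ , ⊥' , ⊥' ⟩ ⨾ ⇒-postcomp (extra n◇ var)

  ¬¬□⇒□¬¬ : N◇ ∈ Ax → I◇□ ∈ Ax → Ax ⊢ (¬' (¬' (□ φ)) ⇒ □ (¬' (¬' φ)))
  ¬¬□⇒□¬¬ {φ} n◇ i◇□ =
    contrapose (⇒-swap (□⇒¬◇¬ n◇))
    ⨾ ⇒-postcomp (base ax-⊥ ⟨ □ ⊥' , ⊥' , ⊥' ⟩)
    ⨾ extra i◇□ ⟨ ¬' φ , ⊥' , ⊥' ⟩

data 𝟛 : Set where
  bot mid top : 𝟛

infixr 5 _⇒ₕ_
infixr 6 _∨ₕ_
infixr 7 _∧ₕ_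

_⇒ₕ_ : 𝟛 → 𝟛 → 𝟛
bot ⇒ₕ _   = top
mid ⇒ₕ bot = bot
mid ⇒ₕ _   = top
top ⇒ₕ y   = y

_∧ₕ_ : 𝟛 → 𝟛 → 𝟛
bot ∧ₕ _   = bot
mid ∧ₕ bot = bot
mid ∧ₕ _   = mid
top ∧ₕ y   = y

_∨ₕ_ : 𝟛 → 𝟛 → 𝟛
bot ∨ₕ y   = y
mid ∨ₕ top = top
mid ∨ₕ _   = mid
top ∨ₕ _   = top

¬ₕ : 𝟛 → 𝟛
¬ₕ x = x ⇒ₕ bot

□ₕ ◇ₕ : 𝟛 → 𝟛
□ₕ x = mid ∨ₕ x
◇ₕ x = mid ∨ₕ ¬ₕ (¬ₕ x)

Valuation : Set
Valuation = ℕ → 𝟛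

⟦_⟧ : Fm → Valuation → 𝟛
⟦ var n ⟧ v = v n
⟦ ⊥'    ⟧ v = bot
⟦ φ ∧ ψ ⟧ v = ⟦ φ ⟧ v ∧ₕ ⟦ ψ ⟧ v
⟦ φ ∨ ψ ⟧ v = ⟦ φ ⟧ v ∨ₕ ⟦ ψ ⟧ v
⟦ φ ⇒ ψ ⟧ v = ⟦ φ ⟧ v ⇒ₕ ⟦ ψ ⟧ v
⟦ □ φ   ⟧ v = □ₕ (⟦ φ ⟧ v)
⟦ ◇ φ   ⟧ v = ◇ₕ (⟦ φ ⟧ v)

Valid : Fm → Set
Valid φ = ∀ v → ⟦ φ ⟧ v ≡ top

⟦⟧-sub : ∀ σ φ v → ⟦ sub σ φ ⟧ v ≡ ⟦ φ ⟧ (λ n → ⟦ σ n ⟧ v)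
⟦⟧-sub σ (var n) v = refl
⟦⟧-sub σ ⊥'      v = refl
⟦⟧-sub σ (φ ∧ ψ) v = cong₂ _∧ₕ_ (⟦⟧-sub σ φ v) (⟦⟧-sub σ ψ v)
⟦⟧-sub σ (φ ∨ ψ) v = cong₂ _∨ₕ_ (⟦⟧-sub σ φ v) (⟦⟧-sub σ ψ v)
⟦⟧-sub σ (φ ⇒ ψ) v = cong₂ _⇒ₕ_ (⟦⟧-sub σ φ v) (⟦⟧-sub σ ψ v)
⟦⟧-sub σ (□ φ)   v = cong □ₕ (⟦⟧-sub σ φ v)
⟦⟧-sub σ (◇ φ)   v = cong ◇ₕ (⟦⟧-sub σ φ v)

Valid-sub : ∀ σ φ → Valid φ → Valid (sub σ φ)
Valid-sub σ φ valid v = trans (⟦⟧-sub σ φ v) (valid _)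

≟top : (x : 𝟛) → Dec (x ≡ top)
≟top bot = no λ ()
≟top mid = no λ ()
≟top top = yes refl

all? : {P : 𝟛 → Set} → (∀ x → Dec (P x)) → Dec (∀ x → P x)
all? P? = map′ (λ { (pb , pm , pt) → λ { bot → pb ; mid → pm ; top → pt } })
               (λ p → p bot , p mid , p top)
               (P? bot ×-dec P? mid ×-dec P? top)

valid₃? : (φ : Fm) → Dec (∀ x y z → ⟦ φ ⟧ ⟨ x , y , z ⟩ ≡ top)
valid₃? φ = all? λ x → all? λ y → all? λ z → ≟top (⟦ φ ⟧ ⟨ x , y , z ⟩)

-- When φ mentions only p, q and r, ⟦ φ ⟧ ⟨ v 0 , v 1 , v 2 ⟩ and ⟦ φ ⟧ v are definitionally
-- equal, so byTruthTable φ is a proof of Valid φ.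
byTruthTable : (φ : Fm) → {True (valid₃? φ)} → (v : Valuation) → ⟦ φ ⟧ ⟨ v 0 , v 1 , v 2 ⟩ ≡ top
byTruthTable φ {table} v = toWitness table (v 0) (v 1) (v 2)

CKAx-valid : CKAx φ → Valid φ
CKAx-valid {φ} ax-K1 = byTruthTable φ
CKAx-valid {φ} ax-S  = byTruthTable φ
CKAx-valid {φ} ax-∧1 = byTruthTable φ
CKAx-valid {φ} ax-∧2 = byTruthTable φ
CKAx-valid {φ} ax-∧I = byTruthTable φ
CKAx-valid {φ} ax-∨1 = byTruthTable φ
CKAx-valid {φ} ax-∨2 = byTruthTable φ
CKAx-valid {φ} ax-∨E = byTruthTable φ
CKAx-valid {φ} ax-⊥  = byTruthTable φ
CKAx-valid {φ} ax-K□ = byTruthTable φ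
CKAx-valid {φ} ax-K◇ = byTruthTable φ

N◇□-valid : Valid N◇□
N◇□-valid = byTruthTable N◇□

C◇-valid : Valid C◇
C◇-valid = byTruthTable C◇

I◇□-valid : Valid I◇□
I◇□-valid = byTruthTable I◇□

⇒ₕ-mp : ∀ {x y} → x ⇒ₕ y ≡ top → x ≡ top → y ≡ top
⇒ₕ-mp x⇒y≡top refl = x⇒y≡top

□ₕ-top : ∀ {x} → x ≡ top → □ₕ x ≡ top
□ₕ-top refl = refl

sound : All Valid Ax → Ax ⊢ φ → Valid φ
sound valid-Ax (base {φ} ax σ)     = Valid-sub σ φ (CKAx-valid ax)
sound valid-Ax (extra {φ} φ∈Ax σ) = Valid-sub σ φ (All.lookup valid-Ax φ∈Ax)
sound valid-Ax (mp d e) v          = ⇒ₕ-mp (sound valid-Ax d v) (sound valid-Ax e v)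
sound valid-Ax (nec d) v           = □ₕ-top (sound valid-Ax d v)

¬Valid-target : ¬ Valid target
¬Valid-target valid with valid (λ _ → bot)
... | ()

mainTheorem16 : ((N◇ ∷ I◇□ ∷ []) ⊢ target)
    × (¬ ((N◇□ ∷ C◇ ∷ I◇□ ∷ []) ⊢ target))
    × (¬ ((N◇□ ∷ I◇□ ∷ []) ⊢ target))
mainTheorem16 =
  ¬¬□⇒□¬¬ (here refl) (there (here refl)) ,
  underivable ,
  underivable ∘ ⊢-mono (∷⁺ʳ N◇□ (xs⊆x∷xs _ C◇))
  where
  underivable : ¬ ((N◇□ ∷ C◇ ∷ I◇□ ∷ []) ⊢ target)
  underivable = ¬Valid-target ∘ sound (N◇□-valid ∷ C◇-valid ∷ I◇□-valid ∷ [])
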